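{- Let $\mathsf L$ be a modal system. If $\mathsf L$ is closed under forgetting, then it has the uniform interpolation property. More precisely, for every $P\subseteq\mathcal P$, every $p\in\mathcal P$, every $\mathsf L$-satisfiable formula $\phi$ over $P$ and every $\mathsf L$-satisfiable formula $\psi$ over $P\setminus\{p\}$, if $\psi$ is a result of forgetting $p$ in $\phi$ in $\mathsf L$, then for every formula $\chi$ in which $p$ does not occur, $\phi\models_{\mathsf L}\chi$ iff $\psi\models_{\mathsf L}\chi$ (i.e. $\psi$ is a uniform interpolant of $\phi$ in $\mathsf L$ over $P\setminus\{p\}$).
   Context: Fix a finite nonempty set $\mathcal A$ of agents and a countable set $\mathcal P$ of atoms; formulas are those of the language $\phi ::= p \mid \neg\phi \mid \phi\wedge\phi \mid \phi\vee\phi \mid \mathbf{K}_i\phi \mid \mathbf{D}_{\mathcal{B}}\phi \mid \mathbf C\phi$ ($\mathcal B$ a nonempty subset of $\mathcal A$), interpreted on models $M=(S,R,V)$ with relations $R_i$ per agent, $R_{\mathcal B}=\bigcap_{i\in\mathcal B}R_i$, $\mathbf D_{\mathcal B}$ the box for $R_{\mathcal B}$, $\mathbf K_i$ the box for $R_i$, and $\mathbf C$ the box for the transitive closure of $\bigcup_iR_i$. A modal system $\mathsf L$ is one of the systems considered (e.g. $\mathsf K_n\mathbf D,\mathsf D_n\mathbf D,\mathsf T_n\mathbf D,\mathsf{K45}_n\mathbf D,\mathsf{KD45}_n\mathbf D,\mathsf{S5}_n\mathbf D$ and their variants with common knowledge), determined by a class of $\mathsf L$-models (arbitrary, serial, reflexive,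 transitive+Euclidean, serial+transitive+Euclidean, reflexive+transitive+Euclidean relations respectively); $\models_{\mathsf L}$ and $\mathsf L$-satisfiability are relative to that class. A formula is over $P$ if all its atoms are in $P$; $\mathcal P(\phi)$ denotes the atoms of $\phi$. Collective $p$-bisimulation between pointed models $(M,s),(M',s')$: a relation $\rho$ with $(s,s')\in\rho$ such that related worlds agree on all atoms other than $p$, and for every nonempty $\mathcal C\subseteq\mathcal A$ each $R_{\mathcal C}$-successor on one side is matched by a $\rho$-related $R'_{\mathcal C}$-successor on the other (Forth and Back). A formula $\psi$ with $\mathcal P(\psi)\subseteq\mathcal P(\phi)\setminus\{p\}$ is a result of forgetting $p$ in $\phi$ in $\mathsf L$ if (Forth) whenever $(M,s)$ and $(M',s')$ are $\mathsf L$-models with $M,s\models\phi$ and $(M,s),(M',s')$ collectively $p$-bisimilar, $M',s'\models\psi$; and (Back) for every $\mathsf L$-model $(M',s')$ with $M',s'\models\psi$ there is an $\mathsf L$-model $(M,s)$ with $M,s\models\phi$ collectively $p$-bisimilar to $(M',s')$. $\mathsf L$ is closed under forgetting if for every $\mathsf L$-satisfiable $\phi$ and every $p$ there is an $\mathsf L$-satisfiable result of forgetting $p$ in $\phi$. The uniform interpolation property: for every finite $P$, $\mathsf L$-satisfiable $\phi$ over $P$ and $p\in P$ there is an $\mathsf L$-satisfiable $\psi$ over $P\setminus\{p\}$ with $\phi\models_{\mathsf L}\chi\iff\psi\models_{\mathsf L}\chi$ for all $\chi$ not containing $p$. -}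

module Defs where

open import Level using (Level; 0ℓ) renaming (suc to lsuc)
open import Data.Nat using (ℕ; suc)
open import Data.Fin using (Fin)
open import Data.Fin.Subset using (Subset; _∈_; Nonempty)
open import Data.Bool using (Bool; true)
open import Data.Product using (Σ; ∃; _×_; _,_)
open import Data.Sum using (_⊎_)
open import Data.Empty using (⊥)
open import Data.Unit using (⊤)
open import Relation.Nullary using (¬_)
open import Relation.Binary.PropositionalEquality using (_≡_; _≢_)
open import Function.Bundles using (_⇔_)

module _ (n : ℕ) where

  Agent : Set
  Agent = Fin (suc n)

  Atom : Set
  Atom = ℕ

  data Form : Set where
    atom : Atom → Form
    neg  : Form → Form
    and  : Form → Form → Form
    or   : Form → Form → Form
    K    : Agent → Form → Form
    D    : (B : Subset (suc n)) → Nonempty B → Form → Form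
    C    : Form → Form

  data Occurs (q : Atom) : Form → Set where
    here  : Occurs q (atom q)
    inNeg : ∀ {φ} → Occurs q φ → Occurs q (neg φ)
    inAndˡ : ∀ {φ ψ} → Occurs q φ → Occurs q (and φ ψ)
    inAndʳ : ∀ {φ ψ} → Occurs q ψ → Occurs q (and φ ψ)
    inOrˡ : ∀ {φ ψ} → Occurs q φ → Occurs q (or φ ψ)
    inOrʳ : ∀ {φ ψ} → Occurs q ψ → Occurs q (or φ ψ)
    inK   : ∀ {i φ} → Occurs q φ → Occurs q (K i φ)
    inD   : ∀ {B ne φ} → Occurs q φ → Occurs q (D B ne φ)
    inC   : ∀ {φ} → Occurs q φ → Occurs q (C φ)

  Over : (Atom → Set) → Form → Set
  Over P φ = ∀ q → Occurs q φ → P q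

  data HasC : Form → Set where
    here  : ∀ {φ} → HasC (C φ)
    inNeg : ∀ {φ} → HasC φ → HasC (neg φ)
    inAndˡ : ∀ {φ ψ} → HasC φ → HasC (and φ ψ)
    inAndʳ : ∀ {φ ψ} → HasC ψ → HasC (and φ ψ)
    inOrˡ : ∀ {φ ψ} → HasC φ → HasC (or φ ψ)
    inOrʳ : ∀ {φ ψ} → HasC ψ → HasC (or φ ψ)
    inK   : ∀ {i φ} → HasC φ → HasC (K i φ)
    inD   : ∀ {B ne φ} → HasC φ → HasC (D B ne φ)
    inC   : ∀ {φ} → HasC φ → HasC (C φ)

  record Model : Set₁ where
    field
      S : Set
      R : Agent → S → S → Set
      V : S → Atom → Bool

  module _ (M : Model) where
    open Model M

    RB : Subset (suc n) → S → S → Set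
    RB B s t = ∀ i → i ∈ B → R i s t

    data TC : S → S → Set where
      step  : ∀ {s t} i → R i s t → TC s t
      trans : ∀ {s t u} i → R i s t → TC t u → TC s u

    Sat : S → Form → Set
    Sat s (atom p) = V s p ≡ true
    Sat s (neg φ) = ¬ (Sat s φ)
    Sat s (and φ ψ) = (Sat s φ) × (Sat s ψ)
    Sat s (or φ ψ) = (Sat s φ) ⊎ (Sat s ψ)
    Sat s (K i φ) = ∀ t → R i s t → Sat t φ
    Sat s (D B _ φ) = ∀ t → RB B s t → Sat t φ
    Sat s (C φ) = ∀ t → TC s t → Sat t φ

  Serial : {S : Set} → (S → S → Set) → Set
  Serial {S} r = ∀ s → ∃ λ t → r s t

  Reflexive : {S : Set} → (S → S → Set) → Set
  Reflexive {S} r = ∀ s → r s s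

  Transitive : {S : Set} → (S → S → Set) → Set
  Transitive {S} r = ∀ s t u → r s t → r t u → r s u

  Euclidean : {S : Set} → (S → S → Set) → Set
  Euclidean {S} r = ∀ s t u → r s t → r s u → r t u

  data FrameClass : Set where
    kK kD kT kK45 kKD45 kS5 : FrameClass

  CondOn : FrameClass → {S : Set} → (S → S → Set) → Set
  CondOn kK    r = ⊤
  CondOn kD    r = Serial r
  CondOn kT    r = Reflexive r
  CondOn kK45  r = Transitive r × Euclidean r
  CondOn kKD45 r = Serial r × Transitive r × Euclidean r
  CondOn kS5   r = Reflexive r × Transitive r × Euclidean r

  -- A modal system: a class of models, and whether the language includes C
  -- (withC = true: the "with common knowledge" variant, e.g. K_n D C;
  --  withC = false: e.g. K_n D, formulas are C-free).
  record System : Set where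
    constructor system
    field
      frames : FrameClass
      withC  : Bool

  InLang : System → Form → Set
  InLang (system _ true) φ = ⊤
  InLang (system _ _) φ = ¬ HasC φ

  IsLModel : System → Model → Set
  IsLModel L M = ∀ i → CondOn (System.frames L) (Model.R M i)

  LSat : System → Form → Set₁
  LSat L φ = Σ Model λ M → IsLModel L M × ∃ λ s → Sat M s φ

  LEntails : System → Form → Form → Set₁
  LEntails L φ χ = ∀ (M : Model) → IsLModel L M → ∀ s → Sat M s φ → Sat M s χ

  IsCollBisim : Atom → (M M' : Model) → (Model.S M → Model.S M' → Set) → Set
  IsCollBisim p M M' ρ =
      (∀ s s' → ρ s s' → ∀ q → q ≢ p → Model.V M s q ≡ Model.V M' s' q)
    × (∀ (Cs : Subset (suc n)) → Nonempty Cs → ∀ s s' → ρ s s' →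
         ∀ t → RB M Cs s t → ∃ λ t' → RB M' Cs s' t' × ρ t t')
    × (∀ (Cs : Subset (suc n)) → Nonempty Cs → ∀ s s' → ρ s s' →
         ∀ t' → RB M' Cs s' t' → ∃ λ t → RB M Cs s t × ρ t t')

  CollBisimilar : Atom → (M : Model) → Model.S M → (M' : Model) → Model.S M' → Set₁
  CollBisimilar p M s M' s' =
    Σ (Model.S M → Model.S M' → Set) λ ρ → ρ s s' × IsCollBisim p M M' ρ

  IsForgetting : System → Atom → Form → Form → Set₁
  IsForgetting L p φ ψ =
      (∀ q → Occurs q ψ → Occurs q φ × q ≢ p)
    × (∀ M s M' s' → IsLModel L M → IsLModel L M' → Sat M s φ →
         CollBisimilar p M s M' s' → Sat M' s' ψ)
    × (∀ M' s' → IsLModel L M' → Sat M' s' ψ →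
         Σ Model λ M → IsLModel L M × ∃ λ s → Sat M s φ × CollBisimilar p M s M' s')

{-# OPTIONS --safe #-}
module Submission where

open import Defs
open import Data.Nat using (ℕ)
open import Data.Fin.Subset using (Nonempty; ⁅_⁆)
open import Data.Fin.Subset.Properties using (x∈⁅x⁆; x∈⁅y⁆⇒x≡y)
open import Data.Product using (_×_; _,_; ∃)
open import Data.Sum using (inj₁; inj₂)
open import Function using (_∘_; flip)
open import Function.Bundles using (_⇔_; mk⇔)
open import Relation.Nullary using (¬_)
open import Relation.Binary.PropositionalEquality as ≡ using (_≡_; _≢_; refl; sym; subst)

-- Formulas without p are invariant under collective p-bisimulation; for K_i
-- one uses the singleton coalition {i}, for C a chain of singleton steps.
-- If φ ⊨ χ and ψ holds at s', the Back clause of forgetting yields a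
-- φ-world collectively p-bisimilar to s'; χ holds there, hence at s'.
-- Conversely every φ-world is p-bisimilar to itself via identity, so by the
-- Forth clause it satisfies ψ and thus χ.

module _ {n : ℕ} (M : Model n) where
  open Model M

  R⇒RB-⁅⁆ : ∀ {i s t} → R i s t → RB n M ⁅ i ⁆ s t
  R⇒RB-⁅⁆ {i} r j j∈⁅i⁆ =
    subst (λ k → R k _ _) (sym (x∈⁅y⁆⇒x≡y i j∈⁅i⁆)) r

  RB-⁅⁆⇒R : ∀ {i s t} → RB n M ⁅ i ⁆ s t → R i s t
  RB-⁅⁆⇒R {i} r = r i (x∈⁅x⁆ i)

⁅⁆-nonempty : ∀ {n} (i : Agent n) → Nonempty ⁅ i ⁆
⁅⁆-nonempty i = i , x∈⁅x⁆ i

module _ {n : ℕ} (p : Atom n) {M M' : Model n} where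

  collBisim-flip : ∀ {ρ} → IsCollBisim n p M M' ρ → IsCollBisim n p M' M (flip ρ)
  collBisim-flip (agree , forth , back) =
    (λ s' s r q q≢p → sym (agree s s' r q q≢p)) ,
    (λ Cs ne s' s r → back Cs ne s s' r) ,
    (λ Cs ne s' s r → forth Cs ne s s' r)

  collBisim-TC-forth : ∀ {ρ} → IsCollBisim n p M M' ρ → ∀ {s s' t} → ρ s s' →
                       TC n M s t → ∃ λ t' → TC n M' s' t' × ρ t t'
  collBisim-TC-forth (_ , forth , _) {s} {s'} r (step i x)
    with forth ⁅ i ⁆ (⁅⁆-nonempty i) s s' r _ (R⇒RB-⁅⁆ M x)
  ... | t' , x' , r' = t' , step i (RB-⁅⁆⇒R M' x') , r'
  collBisim-TC-forth bisim@(_ , forth , _) {s} {s'} r (trans i x tc)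
    with forth ⁅ i ⁆ (⁅⁆-nonempty i) s s' r _ (R⇒RB-⁅⁆ M x)
  ... | u' , x' , r' with collBisim-TC-forth bisim r' tc
  ... | t' , tc' , r'' = t' , trans i (RB-⁅⁆⇒R M' x') tc' , r''

collBisim-preserves-Sat : ∀ {n} (p : Atom n) {M M' : Model n} {ρ} →
                          IsCollBisim n p M M' ρ → ∀ χ → ¬ Occurs n p χ →
                          ∀ {s s'} → ρ s s' → Sat n M s χ → Sat n M' s' χ
collBisim-preserves-Sat p (agree , _ , _) (atom q) p∉χ {s} {s'} r h =
  ≡.trans (sym (agree s s' r q λ { refl → p∉χ here })) h
collBisim-preserves-Sat p bisim (neg χ) p∉χ r h h' =
  h (collBisim-preserves-Sat p (collBisim-flip p bisim) χ (p∉χ ∘ inNeg) r h')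
collBisim-preserves-Sat p bisim (and χ θ) p∉χ r (hχ , hθ) =
  collBisim-preserves-Sat p bisim χ (p∉χ ∘ inAndˡ) r hχ ,
  collBisim-preserves-Sat p bisim θ (p∉χ ∘ inAndʳ) r hθ
collBisim-preserves-Sat p bisim (or χ θ) p∉χ r (inj₁ h) =
  inj₁ (collBisim-preserves-Sat p bisim χ (p∉χ ∘ inOrˡ) r h)
collBisim-preserves-Sat p bisim (or χ θ) p∉χ r (inj₂ h) =
  inj₂ (collBisim-preserves-Sat p bisim θ (p∉χ ∘ inOrʳ) r h)
collBisim-preserves-Sat p {M} {M'} bisim@(_ , _ , back) (K i χ) p∉χ {s} {s'} r h t' x'
  with back ⁅ i ⁆ (⁅⁆-nonempty i) s s' r t' (R⇒RB-⁅⁆ M' x')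
... | t , x , r' = collBisim-preserves-Sat p bisim χ (p∉χ ∘ inK) r' (h t (RB-⁅⁆⇒R M x))
collBisim-preserves-Sat p bisim@(_ , _ , back) (D Cs ne χ) p∉χ {s} {s'} r h t' x'
  with back Cs ne s s' r t' x'
... | t , x , r' = collBisim-preserves-Sat p bisim χ (p∉χ ∘ inD) r' (h t x)
collBisim-preserves-Sat p bisim (C χ) p∉χ r h t' tc'
  with collBisim-TC-forth p (collBisim-flip p bisim) r tc'
... | t , tc , r' = collBisim-preserves-Sat p bisim χ (p∉χ ∘ inC) r' (h t tc)

collBisim-refl : ∀ {n} (p : Atom n) (M : Model n) → IsCollBisim n p M M _≡_
collBisim-refl p M =
  (λ { s .s refl q _ → refl }) ,
  (λ { Cs _ s .s refl t x → t , x , refl }) ,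
  (λ { Cs _ s .s refl t x → t , x , refl })

proposition3p5 : (n : ℕ) (L : System n) (P : ℕ → Set) (p : ℕ) (φ ψ : Form n) →
    InLang n L φ → InLang n L ψ →
    LSat n L φ → Over n P φ →
    LSat n L ψ → Over n (λ q → P q × q ≢ p) ψ →
    IsForgetting n L p φ ψ →
    ∀ (χ : Form n) → InLang n L χ → ¬ Occurs n p χ →
    (LEntails n L φ χ ⇔ LEntails n L ψ χ)
proposition3p5 n L P p φ ψ _ _ _ _ _ _ (_ , forget-forth , forget-back) χ _ p∉χ =
  mk⇔ φ⊨χ⇒ψ⊨χ ψ⊨χ⇒φ⊨χ
  where
  φ⊨χ⇒ψ⊨χ : LEntails n L φ χ → LEntails n L ψ χ
  φ⊨χ⇒ψ⊨χ φ⊨χ M' M'∈L s' ψ-at-s' with forget-back M' s' M'∈L ψ-at-s'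
  ... | M , M∈L , s , φ-at-s , ρ , ρss' , bisim =
    collBisim-preserves-Sat p bisim χ p∉χ ρss' (φ⊨χ M M∈L s φ-at-s)

  ψ⊨χ⇒φ⊨χ : LEntails n L ψ χ → LEntails n L φ χ
  ψ⊨χ⇒φ⊨χ ψ⊨χ M M∈L s φ-at-s =
    ψ⊨χ M M∈L s
      (forget-forth M s M s M∈L M∈L φ-at-s (_≡_ , refl , collBisim-refl p M))
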